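{- Let $t$ and $u$ be terms, $x$ a variable, and $n$ an integer with $n\ge \mathrm{rank}(t)$. (1) If $x\notin TV(t)$ and $no(x,t)=k$, then $W_n(t[u/x])\le W_n(t)+k\,W_n(u)$. (2) If $x\in TV(t)$, then $W_n(t[u/x])\le W_n(t)+n\,W_n(u)$.
   Context: Pseudo-terms are given by the grammar $t ::= x \mid \lambda x.t \mid (t\,t') \mid\, !t \mid \mathrm{let}\ t\ \mathrm{be}\ !x\ \mathrm{in}\ t'$. In $\mathrm{let}\ u\ \mathrm{be}\ !x\ \mathrm{in}\ t_1$ the variable $x$ is bound in $t_1$: $FV(\mathrm{let}\ u\ \mathrm{be}\ !x\ \mathrm{in}\ t_1)=FV(u)\cup(FV(t_1)\setminus\{x\})$; $\lambda$ binds as usual. $FV(t)$ is the set of free variables of $t$, and $no(x,t)$ is the number of free occurrences of $x$ in $t$. Terms and their sets of temporary variables $TV(t)\subseteq FV(t)$ are defined simultaneously as the smallest set of pseudo-terms such that: (i) a variable $x$ is a term, $TV(x)=\emptyset$; (ii) $\lambda x.t$ is a term iff $t$ is a term, $x\notin TV(t)$ and $no(x,t)\le 1$, and then $TV(\lambda x.t)=TV(t)$; (iii) $(t_1\,t_2)$ is a term iff $t_1,t_2$ are terms, $TV(t_1)\cap FV(t_2)=\emptyset$ and $FV(t_1)\cap TV(t_2)=\emptyset$, and then $TV(t_1\,t_2)=TV(t_1)\cup TV(t_2)$; (iv) $!t$ is a term iff $t$ is a term, $TV(t)=\emptyset$ and $no(x,t)=1$ for all $x\in FV(t)$, and then $TV(!t)=FV(t)$;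 (v) $\mathrm{let}\ t_1\ \mathrm{be}\ !x\ \mathrm{in}\ t_2$ is a term iff $t_1,t_2$ are terms, $TV(t_1)\cap FV(t_2)=\emptyset$ and $FV(t_1)\cap TV(t_2)=\emptyset$, and then its $TV$ is $TV(t_1)\cup(TV(t_2)\setminus\{x\})$. $t[u/x]$ denotes capture-avoiding substitution. Rank: $\mathrm{rank}(x)=0$, $\mathrm{rank}(\lambda x.t)=\mathrm{rank}(t)$, $\mathrm{rank}(t_1\,t_2)=\max(\mathrm{rank}(t_1),\mathrm{rank}(t_2))$, $\mathrm{rank}(!t)=\mathrm{rank}(t)$, and $\mathrm{rank}(\mathrm{let}\ u\ \mathrm{be}\ !x\ \mathrm{in}\ t_1)$ equals $\max(\mathrm{rank}(u),\mathrm{rank}(t_1))$ if $x\in TV(t_1)$ and $\max(\mathrm{rank}(u),\mathrm{rank}(t_1),no(x,t_1))$ if $x\notin TV(t_1)$. Weight, for an integer $n$: $W_n(x)=1$, $W_n(\lambda x.t)=W_n(t)+1$, $W_n(!u)=n\,W_n(u)+1$, $W_n(t_1\,t_2)=W_n(t_1)+W_n(t_2)$, $W_n(\mathrm{let}\ u\ \mathrm{be}\ !x\ \mathrm{in}\ t_1)=W_n(u)+W_n(t_1)$. -}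

module Defs where

open import Data.Nat using (ℕ; zero; suc; _+_; _*_; _≤_; _⊔_; _≡ᵇ_)
open import Data.Bool using (Bool; true; false; _∨_; if_then_else_)
open import Relation.Binary.PropositionalEquality using (_≡_)
open import Data.Product using (_×_)

-- Pseudo-terms, with bound variables represented by de Bruijn indices
-- (terms are thus identified up to alpha-conversion).  A variable is a
-- natural number; under a binder the index 0 is the bound variable and
-- index (suc y) refers to the outer variable y.
--   lam t       ~  λx.t               (x = index 0 in t)
--   letb u t    ~  let u be !x in t   (x = index 0 in t, not bound in u)
data PTerm : Set where
  var  : ℕ → PTerm
  lam  : PTerm → PTerm
  app  : PTerm → PTerm → PTerm
  bang : PTerm → PTerm
  letb : PTerm → PTerm → PTerm

no : ℕ → PTerm → ℕ
no x (var y)    = if x ≡ᵇ y then 1 else 0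
no x (lam t)    = no (suc x) t
no x (app a b)  = no x a + no x b
no x (bang t)   = no x t
no x (letb u t) = no x u + no (suc x) t

fv : ℕ → PTerm → Bool
fv x (var y)    = x ≡ᵇ y
fv x (lam t)    = fv (suc x) t
fv x (app a b)  = fv x a ∨ fv x b
fv x (bang t)   = fv x t
fv x (letb u t) = fv x u ∨ fv (suc x) t

tv : ℕ → PTerm → Bool
tv x (var y)    = false
tv x (lam t)    = tv (suc x) t
tv x (app a b)  = tv x a ∨ tv x b
tv x (bang t)   = fv x t
tv x (letb u t) = tv x u ∨ tv (suc x) t

-- disjointness side conditions of clauses (iii) and (v);
-- d is the number of variables bound in the right-hand component
Compat : ℕ → PTerm → PTerm → Set
Compat d a b = (y : ℕ) →
  (tv y a ≡ true → fv (d + y) b ≡ false) × (fv y a ≡ true → tv (d + y) b ≡ false)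

data IsTerm : PTerm → Set where
  t-var  : ∀ x → IsTerm (var x)
  t-lam  : ∀ {t} → IsTerm t → tv 0 t ≡ false → no 0 t ≤ 1 → IsTerm (lam t)
  t-app  : ∀ {a b} → IsTerm a → IsTerm b → Compat 0 a b → IsTerm (app a b)
  t-bang : ∀ {t} → IsTerm t → (∀ y → tv y t ≡ false) →
           (∀ y → fv y t ≡ true → no y t ≡ 1) → IsTerm (bang t)
  t-let  : ∀ {u t} → IsTerm u → IsTerm t → Compat 1 u t → IsTerm (letb u t)

rank : PTerm → ℕ
rank (var x)    = 0
rank (lam t)    = rank t
rank (app a b)  = rank a ⊔ rank b
rank (bang t)   = rank t
rank (letb u t) = if tv 0 t then rank u ⊔ rank t else rank u ⊔ rank t ⊔ no 0 t

W : ℕ → PTerm → ℕ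
W n (var x)    = 1
W n (lam t)    = W n t + 1
W n (bang u)   = n * W n u + 1
W n (app a b)  = W n a + W n b
W n (letb u t) = W n u + W n t

shift : ℕ → PTerm → PTerm
shift c (var y)    = if c Data.Nat.≤ᵇ y then var (suc y) else var y
shift c (lam t)    = lam (shift (suc c) t)
shift c (app a b)  = app (shift c a) (shift c b)
shift c (bang t)   = bang (shift c t)
shift c (letb u t) = letb (shift c u) (shift (suc c) t)

-- capture-avoiding substitution t[u/x]; the free variables other than x
-- keep their names (no index is decremented)
subst : PTerm → ℕ → PTerm → PTerm
subst (var y)    x u = if x ≡ᵇ y then u else var y
subst (lam t)    x u = lam (subst t (suc x) (shift 0 u))
subst (app a b)  x u = app (subst a x u) (subst b x u)
subst (bang t)   x u = bang (subst t x u)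
subst (letb v t) x u = letb (subst v x u) (subst t (suc x) (shift 0 u))

{-# OPTIONS --safe #-}
-- If x is not temporary in t, no occurrence of x lies under
-- a !, since x ∈ FV(s) makes x temporary in !s; so each of the no(x,t) copies
-- of u enters the weight unscaled (this part holds for all pseudo-terms).  If
-- x is temporary in t, the disjointness conditions of clauses (iii) and (v)
-- leave x free only in the component where it is temporary, down to a !s with
-- x free in s; there clause (iv) gives no(x,s) = 1 and TV(s) = ∅, so the first
-- part applies to s with k = 1 and the single copy of u is scaled by n.
module Submission where

open import Defs
open import Data.Nat using (ℕ; _+_; _*_; _≤_; _≡ᵇ_; _≤ᵇ_; suc)
open import Data.Nat.Properties
  using (≤-refl; ≤-trans; ≤-reflexive; n≤1+n; m≤m+n; +-mono-≤; +-monoˡ-≤; +-monoʳ-≤;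
         *-monoʳ-≤; +-assoc; +-identityʳ; *-identityˡ; *-distribˡ-+; *-distribʳ-+;
         +-commutativeSemigroup)
open import Algebra.Properties.CommutativeSemigroup +-commutativeSemigroup
  using (interchange; xy∙z≈xz∙y)
open import Data.Bool using (true; false; _∨_)
open import Data.Bool.Properties using (∨-conicalˡ; ∨-conicalʳ)
open import Data.Product using (_×_; _,_; proj₁; proj₂)
open import Relation.Binary.PropositionalEquality
  using (_≡_; refl; sym; trans; cong; cong₂; module ≡-Reasoning)
import Relation.Binary.PropositionalEquality as ≡
open import Relation.Nullary using (contradiction)

≤-extra-+ʳ : ∀ {m} a c e → m ≤ a + e → m + c ≤ (a + c) + e
≤-extra-+ʳ a c e h = ≤-trans (+-monoˡ-≤ c h) (≤-reflexive (xy∙z≈xz∙y a e c))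

≤-extra-+ˡ : ∀ {m} c a e → m ≤ a + e → c + m ≤ (c + a) + e
≤-extra-+ˡ c a e h = ≤-trans (+-monoʳ-≤ c h) (≤-reflexive (sym (+-assoc c a e)))

≤-linear-+ : ∀ {m a m′ a′} k k′ w → m ≤ a + k * w → m′ ≤ a′ + k′ * w →
             m + m′ ≤ (a + a′) + (k + k′) * w
≤-linear-+ {a = a} {a′ = a′} k k′ w h h′ = ≤-trans (+-mono-≤ h h′) (≤-reflexive (begin
  (a + k * w) + (a′ + k′ * w)  ≡⟨ interchange a (k * w) a′ (k′ * w) ⟩
  (a + a′) + (k * w + k′ * w)  ≡⟨ cong (a + a′ +_) (sym (*-distribʳ-+ w k k′)) ⟩
  (a + a′) + (k + k′) * w      ∎))
  where open ≡-Reasoning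

W-shift : ∀ n c u → W n (shift c u) ≡ W n u
W-shift n c (var y) with c ≤ᵇ y
... | true  = refl
... | false = refl
W-shift n c (lam t)    = cong (_+ 1) (W-shift n (suc c) t)
W-shift n c (app a b)  = cong₂ _+_ (W-shift n c a) (W-shift n c b)
W-shift n c (bang t)   = cong (λ w → n * w + 1) (W-shift n c t)
W-shift n c (letb a b) = cong₂ _+_ (W-shift n c a) (W-shift n (suc c) b)

no-fresh : ∀ x t → fv x t ≡ false → no x t ≡ 0
no-fresh x (var y)    p rewrite p = refl
no-fresh x (lam t)    p = no-fresh (suc x) t p
no-fresh x (app a b)  p =
  cong₂ _+_ (no-fresh x a (∨-conicalˡ _ _ p)) (no-fresh x b (∨-conicalʳ _ _ p))
no-fresh x (bang t)   p = no-fresh x t p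
no-fresh x (letb a b) p =
  cong₂ _+_ (no-fresh x a (∨-conicalˡ _ _ p)) (no-fresh (suc x) b (∨-conicalʳ _ _ p))

subst-fresh : ∀ x t u → fv x t ≡ false → subst t x u ≡ t
subst-fresh x (var y)    u p rewrite p = refl
subst-fresh x (lam t)    u p = cong lam (subst-fresh (suc x) t (shift 0 u) p)
subst-fresh x (app a b)  u p =
  cong₂ app (subst-fresh x a u (∨-conicalˡ _ _ p)) (subst-fresh x b u (∨-conicalʳ _ _ p))
subst-fresh x (bang t)   u p = cong bang (subst-fresh x t u p)
subst-fresh x (letb a b) u p =
  cong₂ letb (subst-fresh x a u (∨-conicalˡ _ _ p))
             (subst-fresh (suc x) b (shift 0 u) (∨-conicalʳ _ _ p))

≤-W-shift : ∀ {m a} n k u → m ≤ a + k * W n (shift 0 u) → m ≤ a + k * W n u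
≤-W-shift n k u = ≡.subst (λ w → _ ≤ _ + k * w) (W-shift n 0 u)

Compat-freshˡ : ∀ d a b y → Compat d a b → tv (d + y) b ≡ true → fv y a ≡ false
Compat-freshˡ d a b y c p with fv y a in e
... | false = refl
... | true  = contradiction (trans (sym (proj₂ (c y) e)) p) λ ()

W-subst-nontemporary : ∀ n t x u → tv x t ≡ false →
                       W n (subst t x u) ≤ W n t + no x t * W n u
W-subst-nontemporary n (var y) x u p with x ≡ᵇ y
... | true  = ≤-trans (≤-reflexive (sym (+-identityʳ (W n u)))) (n≤1+n _)
... | false = ≤-refl
W-subst-nontemporary n (lam t) x u p =
  ≤-extra-+ʳ (W n t) 1 (no (suc x) t * W n u)
    (≤-W-shift n (no (suc x) t) u (W-subst-nontemporary n t (suc x) (shift 0 u) p))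
W-subst-nontemporary n (app a b) x u p =
  ≤-linear-+ (no x a) (no x b) (W n u)
    (W-subst-nontemporary n a x u (∨-conicalˡ _ _ p))
    (W-subst-nontemporary n b x u (∨-conicalʳ _ _ p))
W-subst-nontemporary n (bang t) x u p
  rewrite subst-fresh x t u p | no-fresh x t p = m≤m+n _ 0
W-subst-nontemporary n (letb a b) x u p =
  ≤-linear-+ (no x a) (no (suc x) b) (W n u)
    (W-subst-nontemporary n a x u (∨-conicalˡ _ _ p))
    (≤-W-shift n (no (suc x) b) u
      (W-subst-nontemporary n b (suc x) (shift 0 u) (∨-conicalʳ _ _ p)))

W-subst-temporary : ∀ n t x u → IsTerm t → tv x t ≡ true →
                    W n (subst t x u) ≤ W n t + n * W n u
W-subst-temporary n (var y) x u _ ()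
W-subst-temporary n (lam t) x u (t-lam t-term _ _) p =
  ≤-extra-+ʳ (W n t) 1 (n * W n u)
    (≤-W-shift n n u (W-subst-temporary n t (suc x) (shift 0 u) t-term p))
W-subst-temporary n (app a b) x u (t-app a-term b-term c) p with tv x a in e
... | true  rewrite subst-fresh x b u (proj₁ (c x) e) =
  ≤-extra-+ʳ (W n a) (W n b) (n * W n u) (W-subst-temporary n a x u a-term e)
... | false rewrite subst-fresh x a u (Compat-freshˡ 0 a b x c p) =
  ≤-extra-+ˡ (W n a) (W n b) (n * W n u) (W-subst-temporary n b x u b-term p)
W-subst-temporary n (bang t) x u (t-bang _ no-tv once) p =
  ≤-extra-+ʳ (n * W n t) 1 (n * W n u)
    (≤-trans (*-monoʳ-≤ n single-copy) (≤-reflexive (*-distribˡ-+ n (W n t) (W n u))))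
  where
  single-copy : W n (subst t x u) ≤ W n t + W n u
  single-copy = ≡.subst (λ k → W n (subst t x u) ≤ W n t + k)
    (trans (cong (_* W n u) (once x p)) (*-identityˡ (W n u)))
    (W-subst-nontemporary n t x u (no-tv x))
W-subst-temporary n (letb a b) x u (t-let a-term b-term c) p with tv x a in e
... | true  rewrite subst-fresh (suc x) b (shift 0 u) (proj₁ (c x) e) =
  ≤-extra-+ʳ (W n a) (W n b) (n * W n u) (W-subst-temporary n a x u a-term e)
... | false rewrite subst-fresh x a u (Compat-freshˡ 1 a b x c p) =
  ≤-extra-+ˡ (W n a) (W n b) (n * W n u)
    (≤-W-shift n n u (W-subst-temporary n b (suc x) (shift 0 u) b-term p))

mainTheorem14 : (t u : PTerm) (x n : ℕ) → IsTerm t → IsTerm u → rank t ≤ n →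
    ((k : ℕ) → tv x t ≡ false → no x t ≡ k → W n (subst t x u) ≤ W n t + k * W n u)
    × (tv x t ≡ true → W n (subst t x u) ≤ W n t + n * W n u)
mainTheorem14 t u x n t-term _ _ =
  (λ { _ p refl → W-subst-nontemporary n t x u p }) , W-subst-temporary n t x u t-term
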